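{- Let $G$ be a simple undirected unweighted graph without loops on the vertex set $\{1,\dots,n\}$, with Laplacian matrix $L$ and vertex degree sequence $\vec{d}=(d_1,\dots,d_n)^\top$. If for some real $n\times n$ matrix $D$ the identity $$LD+2I=(2\cdot\vec{1}-\vec{d})\vec{1}^\top$$ holds, then $G$ is a tree. If, moreover, $D$ has zero diagonal, then $D$ is the distance matrix of the tree $G$.
   Context: $I$ is the identity matrix and $\vec{1}$ the all-ones column vector of dimension $n$. For an unweighted graph with adjacency matrix $X$, the degree sequence is $\vec{d}=X\vec{1}$ and the Laplacian is $L=\operatorname{diag}(X\vec{1})-X$. The distance matrix has zero diagonal and $(i,j)$-entry equal to the number of edges of a shortest path between $i$ and $j$. -}

module Defs where

open import Level using (Level)
open import Algebra.Bundles using (CommutativeRing)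
open import Data.Nat using (ℕ; zero; suc; _≤_)
open import Data.Fin using (Fin; zero; suc; inject₁; fromℕ; _≟_)
open import Data.Bool using (Bool; true; false; if_then_else_)
open import Data.Product using (Σ; _×_; ∃)
open import Relation.Nullary using (¬_; does)
open import Relation.Binary.PropositionalEquality using (_≡_)
open import Function.Definitions using (Injective)

record SimpleGraph (n : ℕ) : Set where
  field
    Adj      : Fin n → Fin n → Bool
    symmetric : ∀ i j → Adj i j ≡ Adj j i
    loopless : ∀ i → Adj i i ≡ false
open SimpleGraph public

∑ℕ : ∀ {n} → (Fin n → ℕ) → ℕ
∑ℕ {zero}  f = 0
∑ℕ {suc n} f = f zero Data.Nat.+ ∑ℕ (λ k → f (suc k))

degree : ∀ {n} → SimpleGraph n → Fin n → ℕ
degree G i = ∑ℕ (λ j → if Adj G i j then 1 else 0)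

data Walk {n} (G : SimpleGraph n) : Fin n → Fin n → ℕ → Set where
  here : ∀ {i} → Walk G i i 0
  step : ∀ {i j k l} → Adj G i j ≡ true → Walk G j k l → Walk G i k (suc l)

Connected : ∀ {n} → SimpleGraph n → Set
Connected G = ∀ i j → ∃ λ l → Walk G i j l

-- a cycle of length m+3: distinct vertices v_0,…,v_{m+2} with v_t ~ v_{t+1}
-- and v_{m+2} ~ v_0
record Cycle {n} (G : SimpleGraph n) : Set where
  field
    m        : ℕ
    v        : Fin (suc (suc (suc m))) → Fin n
    distinct : Injective _≡_ _≡_ v
    edges    : ∀ (t : Fin (suc (suc m))) → Adj G (v (inject₁ t)) (v (suc t)) ≡ true
    closing  : Adj G (v (fromℕ (suc (suc m)))) (v zero) ≡ true

Acyclic : ∀ {n} → SimpleGraph n → Set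
Acyclic G = ¬ Cycle G

-- a tree: a nonempty connected acyclic graph (nonemptiness is n ≥ 1 in the statement)
IsTree : ∀ {n} → SimpleGraph n → Set
IsTree G = Connected G × Acyclic G

module _ {c ℓ : Level} (R : CommutativeRing c ℓ) where
  open CommutativeRing R hiding (zero)

  ι : ℕ → Carrier
  ι zero    = 0#
  ι (suc k) = 1# + ι k

  ∑ : ∀ {n} → (Fin n → Carrier) → Carrier
  ∑ {zero}  f = 0#
  ∑ {suc n} f = f zero + ∑ (λ k → f (suc k))

  Matrix : ℕ → Set c
  Matrix n = Fin n → Fin n → Carrier

  CharZero : Set ℓ
  CharZero = ∀ k → ¬ (ι (suc k) ≈ 0#)

  HasInverses : Set (c Level.⊔ ℓ)
  HasInverses = ∀ x → ¬ (x ≈ 0#) → Σ Carrier λ y → x * y ≈ 1#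

  idMat : ∀ {n} → Matrix n
  idMat i j = if does (i ≟ j) then 1# else 0#

  adjMat : ∀ {n} → SimpleGraph n → Matrix n
  adjMat G i j = if Adj G i j then 1# else 0#

  laplacian : ∀ {n} → SimpleGraph n → Matrix n
  laplacian G i j = (if does (i ≟ j) then ι (degree G i) else 0#) - adjMat G i j

  _⊗_ : ∀ {n} → Matrix n → Matrix n → Matrix n
  (A ⊗ B) i j = ∑ (λ k → A i k * B k j)

  LaplacianIdentity : ∀ {n} → SimpleGraph n → Matrix n → Set ℓ
  LaplacianIdentity G D =
    ∀ i j → (laplacian G ⊗ D) i j + ι 2 * idMat i j ≈ (ι 2 - ι (degree G i)) * 1#

  ZeroDiagonal : ∀ {n} → Matrix n → Set ℓ
  ZeroDiagonal D = ∀ i → D i i ≈ 0#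

  -- D is the distance matrix of G: D i j is the number of edges of a
  -- shortest walk (= shortest path) from i to j
  IsDistanceMatrix : ∀ {n} → SimpleGraph n → Matrix n → Set ℓ
  IsDistanceMatrix G D =
    ∀ i j → Σ ℕ λ k → Walk G i j k × (∀ l → Walk G i j l → k ≤ l) × D i j ≈ ι k

module Submission where

-- Proof.  (1) For a set S of vertices closed under adjacency the row vector
-- χ_S satisfies χ_S L = 0, so multiplying the identity by χ_S gives
-- 2·[j ∈ S] = ∑_{i∈S} (2 − d_i) for every column j.  The right side does not
-- depend on j, so in characteristic zero S is empty or everything.  Applied to
-- the vertices reachable from a root (breadth-first layers) this gives
-- connectivity; applied to S = V it gives ∑ d = 2n − 2.
-- (2) Let δ be the distance to a root j.  Each edge joins a vertex to a lower,
-- equal or higher level, and each vertex ≠ j has a lower neighbour.  Double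
-- counting, 2n − 2 = ∑ d = 2·#lower + #level ≥ 2(n − 1) + #level; hence no edge
-- stays within a level and each vertex has at most one lower neighbour.
-- (3) So G has no cycle: the vertex of a cycle farthest from j would have two
-- distinct lower neighbours on the cycle.
-- (4) Row x ≠ j of the identity reads ∑_k A_xk (D_xj − D_kj + 1) = 2.  By
-- downward induction on δ x, higher neighbours contribute 0, so D_xj − D_yj = 1
-- for the parent y of x; with D_jj = 0 this gives D_xj = δ(x).

open import Defs
open import Level using (Level)
open import Algebra.Bundles using (CommutativeRing)
open import Data.Nat using (ℕ; _≤_)
open import Data.Fin using (Fin; zero)
open import Data.Bool using (Bool; true; false)
open import Data.Product using (_×_; _,_)
open import Relation.Binary.PropositionalEquality using (_≡_)

module NatSums where
  open import Data.Nat using (ℕ; zero; suc; _+_; _*_; _≤_; z≤n; s≤s)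
  open import Data.Nat.Properties
    using ( +-commutativeSemigroup; *-monoˡ-≤; *-cancelʳ-≡; n≤0⇒n≡0; +-mono-≤; +-monoʳ-≤
          ; +-monoˡ-≤; +-cancelʳ-≤; +-cancelˡ-≤; ≤-antisym; ≤-trans; ≤-refl; ≤-reflexive; n≤1+n; m≤n+m; +-suc; +-identityʳ )
  open import Algebra.Properties.CommutativeSemigroup +-commutativeSemigroup using (interchange)
  open import Data.Fin using (Fin; zero; suc)
  open import Data.Fin.Properties using (suc-injective)
  open import Data.Bool using (Bool; true; false; if_then_else_)
  open import Data.Empty using (⊥-elim)
  open import Data.Product using (_×_; _,_)
  open import Data.Nat.Tactic.RingSolver using (solve-∀)
  open import Relation.Binary.PropositionalEquality

  ∑ℕ-cong : ∀ {n} {f g : Fin n → ℕ} → (∀ k → f k ≡ g k) → ∑ℕ f ≡ ∑ℕ g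
  ∑ℕ-cong {zero}  f≡g = refl
  ∑ℕ-cong {suc n} f≡g = cong₂ _+_ (f≡g zero) (∑ℕ-cong (λ k → f≡g (suc k)))

  ∑ℕ-+ : ∀ {n} (f g : Fin n → ℕ) → ∑ℕ (λ k → f k + g k) ≡ ∑ℕ f + ∑ℕ g
  ∑ℕ-+ {zero}  f g = refl
  ∑ℕ-+ {suc n} f g =
    trans (cong (f zero + g zero +_) (∑ℕ-+ (λ k → f (suc k)) (λ k → g (suc k))))
          (interchange (f zero) (g zero) _ _)

  ∑ℕ-const : ∀ n c → ∑ℕ {n} (λ _ → c) ≡ n * c
  ∑ℕ-const zero    c = refl
  ∑ℕ-const (suc n) c = cong (c +_) (∑ℕ-const n c)

  ∑ℕ-0 : ∀ n → ∑ℕ {n} (λ _ → 0) ≡ 0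
  ∑ℕ-0 zero    = refl
  ∑ℕ-0 (suc n) = ∑ℕ-0 n

  ∑ℕ-swap : ∀ {m n} (f : Fin m → Fin n → ℕ) →
            ∑ℕ (λ i → ∑ℕ (f i)) ≡ ∑ℕ (λ k → ∑ℕ (λ i → f i k))
  ∑ℕ-swap {zero}  {n} f = sym (∑ℕ-0 n)
  ∑ℕ-swap {suc m} f =
    trans (cong (∑ℕ (f zero) +_) (∑ℕ-swap (λ i → f (suc i))))
          (sym (∑ℕ-+ (f zero) (λ k → ∑ℕ (λ i → f (suc i) k))))

  ∑ℕ-single : ∀ {n} (f : Fin n → ℕ) y → (∀ x → x ≢ y → f x ≡ 0) → ∑ℕ f ≡ f y
  ∑ℕ-single {suc n} f zero    vanish =
    trans (cong (f zero +_) (trans (∑ℕ-cong (λ k → vanish (suc k) (λ ()))) (∑ℕ-0 n)))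
          (+-identityʳ (f zero))
  ∑ℕ-single {suc n} f (suc y) vanish =
    trans (cong (_+ ∑ℕ (λ k → f (suc k))) (vanish zero (λ ())))
          (∑ℕ-single (λ k → f (suc k)) y (λ x x≢y → vanish (suc x) (λ e → x≢y (suc-injective e))))

  ∑ℕ-mono : ∀ {n} {f g : Fin n → ℕ} → (∀ k → f k ≤ g k) → ∑ℕ f ≤ ∑ℕ g
  ∑ℕ-mono {zero}  f≤g = z≤n
  ∑ℕ-mono {suc n} f≤g = +-mono-≤ (f≤g zero) (∑ℕ-mono (λ k → f≤g (suc k)))

  ∑ℕ-tight : ∀ {n} {f g : Fin n → ℕ} → (∀ k → f k ≤ g k) → ∑ℕ g ≤ ∑ℕ f → ∀ k → f k ≡ g k
  ∑ℕ-tight {suc n} {f} {g} f≤g g≤f zero =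
    ≤-antisym (f≤g zero)
      (+-cancelʳ-≤ _ (g zero) (f zero)
        (≤-trans g≤f (+-monoʳ-≤ (f zero) (∑ℕ-mono (λ k → f≤g (suc k))))))
  ∑ℕ-tight {suc n} {f} {g} f≤g g≤f (suc k) =
    ∑ℕ-tight (λ k → f≤g (suc k)) (+-cancelˡ-≤ (g zero) _ _ (≤-trans g≤f (+-monoˡ-≤ _ (f≤g zero)))) k

  indicator : Bool → ℕ
  indicator b = if b then 1 else 0

  count : ∀ {n} → (Fin n → Bool) → ℕ
  count p = ∑ℕ (λ x → indicator (p x))

  count-≤ : ∀ {n} (p : Fin n → Bool) → count p ≤ n
  count-≤ {zero}  p = z≤n
  count-≤ {suc n} p with p zero
  ... | true  = s≤s (count-≤ (λ k → p (suc k)))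
  ... | false = ≤-trans (count-≤ (λ k → p (suc k))) (n≤1+n n)

  count-≥1 : ∀ {n} (p : Fin n → Bool) y → p y ≡ true → 1 ≤ count p
  count-≥1 p zero    py rewrite py = s≤s z≤n
  count-≥1 p (suc y) py = ≤-trans (count-≥1 (λ k → p (suc k)) y py) (m≤n+m _ (indicator (p zero)))

  count-≥2 : ∀ {n} (p : Fin n → Bool) y z → p y ≡ true → p z ≡ true → y ≢ z → 2 ≤ count p
  count-≥2 p zero    zero    py pz y≢z = ⊥-elim (y≢z refl)
  count-≥2 p zero    (suc z) py pz y≢z rewrite py = s≤s (count-≥1 (λ k → p (suc k)) z pz)
  count-≥2 p (suc y) zero    py pz y≢z rewrite pz = s≤s (count-≥1 (λ k → p (suc k)) y py)
  count-≥2 p (suc y) (suc z) py pz y≢z =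
    ≤-trans (count-≥2 (λ k → p (suc k)) y z py pz (λ e → y≢z (cong suc e)))
            (m≤n+m _ (indicator (p zero)))

  indicator-mono : ∀ {a b} → (a ≡ true → b ≡ true) → indicator a ≤ indicator b
  indicator-mono {false} a⇒b = z≤n
  indicator-mono {true}  a⇒b rewrite a⇒b refl = ≤-refl

  count-strict : ∀ {n} (p q : Fin n → Bool) → (∀ x → p x ≡ true → q x ≡ true) →
                 ∀ y → p y ≡ false → q y ≡ true → suc (count p) ≤ count q
  count-strict p q p⇒q zero py qy rewrite py | qy =
    s≤s (∑ℕ-mono (λ k → indicator-mono (p⇒q (suc k))))
  count-strict p q p⇒q (suc y) py qy =
    ≤-trans (≤-reflexive (sym (+-suc (indicator (p zero)) _)))
            (+-mono-≤ (indicator-mono (p⇒q zero))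
                      (count-strict (λ k → p (suc k)) (λ k → q (suc k)) (λ x → p⇒q (suc x)) y py qy))

  twiceCount : ∀ L S n → 2 + (L + S + L) ≡ n * 2 → n ≤ L + 1 → S ≡ 0 × L + 1 ≡ n
  twiceCount L S n total n≤L+1 =
    S≡0 , *-cancelʳ-≡ (L + 1) n 2
            (trans (sym (+-identityʳ _)) (trans (cong (_ +_) (sym S≡0)) total′))
    where
      regroup : ∀ L S → 2 + (L + S + L) ≡ (L + 1) * 2 + S
      regroup = solve-∀
      total′ : (L + 1) * 2 + S ≡ n * 2
      total′ = trans (sym (regroup L S)) total
      S≡0 : S ≡ 0
      S≡0 = n≤0⇒n≡0 (+-cancelˡ-≤ ((L + 1) * 2) S 0
        (≤-trans (≤-reflexive total′)
                 (≤-trans (*-monoˡ-≤ 2 n≤L+1) (≤-reflexive (sym (+-identityʳ _))))))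

module FiniteSearch where
  open import Data.Nat using (ℕ; zero; suc; _≤_; _<_; z≤n; s≤s)
  open import Data.Fin using (Fin; zero; suc)
  open import Data.Bool using (Bool; true; false; if_then_else_; _∧_; _∨_)
  open import Data.Bool.Properties using (∨-zeroʳ)
  open import Data.Product using (Σ; _×_; _,_)
  open import Relation.Binary.PropositionalEquality

  anyᶠ : ∀ {n} → (Fin n → Bool) → Bool
  anyᶠ {zero}  p = false
  anyᶠ {suc n} p = p zero ∨ anyᶠ (λ k → p (suc k))

  anyᶠ-intro : ∀ {n} (p : Fin n → Bool) y → p y ≡ true → anyᶠ p ≡ true
  anyᶠ-intro p zero    py rewrite py = refl
  anyᶠ-intro p (suc y) py rewrite anyᶠ-intro (λ k → p (suc k)) y py = ∨-zeroʳ (p zero)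

  anyᶠ-elim : ∀ {n} (p : Fin n → Bool) → anyᶠ p ≡ true → Σ (Fin n) λ y → p y ≡ true
  anyᶠ-elim {suc n} p any-p with p zero in p0
  ... | true  = zero , p0
  ... | false with anyᶠ-elim (λ k → p (suc k)) any-p
  ...   | y , py = suc y , py

  ∧-split : ∀ {a b} → a ∧ b ≡ true → (a ≡ true) × (b ≡ true)
  ∧-split {true} {true} refl = refl , refl

  ∧-join : ∀ {a b} → a ≡ true → b ≡ true → a ∧ b ≡ true
  ∧-join refl refl = refl

  -- least p b: the least k ≤ b with p k, or b if there is none
  least : (ℕ → Bool) → ℕ → ℕ
  least p zero    = 0
  least p (suc b) = if p 0 then 0 else suc (least (λ k → p (suc k)) b)

  least-≤ : ∀ p b → least p b ≤ b
  least-≤ p zero    = z≤n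
  least-≤ p (suc b) with p 0
  ... | true  = z≤n
  ... | false = s≤s (least-≤ (λ k → p (suc k)) b)

  least-spec : ∀ p b k → p k ≡ true → k ≤ b → (p (least p b) ≡ true) × (least p b ≤ k)
  least-spec p zero    zero    pk z≤n = pk , z≤n
  least-spec p (suc b) k       pk k≤b with p 0 in p0
  ... | true = p0 , z≤n
  least-spec p (suc b) zero    pk k≤b       | false with () ← trans (sym pk) p0
  least-spec p (suc b) (suc k) pk (s≤s k≤b) | false with least-spec (λ k → p (suc k)) b k pk k≤b
  ... | found , minimal = found , s≤s minimal

  least-minimal : ∀ p b k → k < least p b → p k ≡ false
  least-minimal p (suc b) k       k<least with p 0 in p0
  least-minimal p (suc b) zero    k<least       | false = p0
  least-minimal p (suc b) (suc k) (s≤s k<least) | false = least-minimal (λ k → p (suc k)) b k k<least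

module ClosedSets where
  open import Relation.Binary.PropositionalEquality

  ClosedSet : ∀ {n} → SimpleGraph n → (Fin n → Bool) → Set
  ClosedSet G S = ∀ x y → Adj G x y ≡ true → S y ≡ true → S x ≡ true

  closed-same : ∀ {n} (G : SimpleGraph n) (S : Fin n → Bool) → ClosedSet G S →
                ∀ {x y} → Adj G x y ≡ true → S x ≡ S y
  closed-same G S closed {x} {y} a with S x in sx | S y in sy
  ... | true  | true  = refl
  ... | false | false = refl
  ... | false | true  with () ← trans (sym (closed x y a sy)) sx
  ... | true  | false with () ← trans (sym (closed y x (trans (symmetric G y x) a) sx)) sy

-- Breadth-first search from a root j.  reach k x holds iff x is joined to j
-- by a walk of at most k edges; by step n the layers have stopped growing,
-- so reach n is closed under adjacency.
module Levels {n} (G : SimpleGraph n) (j : Fin n) where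
  open NatSums
  open FiniteSearch
  open ClosedSets
  open import Data.Nat using (ℕ; zero; suc; _*_; _≤_; z≤n; s≤s)
  open import Data.Nat.Properties using (≤-trans; n≤1+n; 1+n≰n)
  open import Data.Fin using (zero; suc; _≟_)
  open import Data.Bool using (false; _∧_; _∨_)
  open import Data.Bool.Properties using (∨-zeroʳ; ¬-not) renaming (_≟_ to _≟ᵇ_)
  open import Data.Fin.Properties using (any?)
  open import Data.Product using (Σ; _×_; _,_; proj₁; proj₂)
  open import Data.Sum using (_⊎_; inj₁; inj₂)
  open import Data.Empty using (⊥-elim)
  open import Relation.Nullary using (¬_; does; yes; no)
  open import Relation.Nullary.Decidable using (dec-true; _×-dec_)
  open import Relation.Binary.PropositionalEquality

  reach : ℕ → Fin n → Bool
  reach zero    x = does (x ≟ j)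
  reach (suc k) x = reach k x ∨ anyᶠ (λ y → Adj G x y ∧ reach k y)

  reach-root : ∀ k → reach k j ≡ true
  reach-root zero    = dec-true (j ≟ j) refl
  reach-root (suc k) rewrite reach-root k = refl

  reach-suc : ∀ {k x} → reach k x ≡ true → reach (suc k) x ≡ true
  reach-suc r rewrite r = refl

  reach-step : ∀ {k x y} → Adj G x y ≡ true → reach k y ≡ true → reach (suc k) x ≡ true
  reach-step {k} {x} {y} a r =
    trans (cong (reach k x ∨_) (anyᶠ-intro _ y (∧-join a r))) (∨-zeroʳ (reach k x))

  reach-suc-cases : ∀ {k x} → reach (suc k) x ≡ true →
    reach k x ≡ true ⊎ Σ (Fin n) λ y → (Adj G x y ≡ true) × (reach k y ≡ true)
  reach-suc-cases {k} {x} r with reach k x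
  ... | true  = inj₁ refl
  ... | false with anyᶠ-elim _ r
  ...   | y , ay = inj₂ (y , ∧-split ay)

  reach-sound : ∀ k x → reach k x ≡ true → Σ ℕ λ l → (l ≤ k) × Walk G x j l
  reach-sound zero    x r with x ≟ j
  ... | yes refl = 0 , z≤n , here
  reach-sound (suc k) x r with reach-suc-cases {k} r
  ... | inj₁ r′ with reach-sound k x r′
  ...   | l , l≤k , w = l , ≤-trans l≤k (n≤1+n k) , w
  reach-sound (suc k) x r | inj₂ (y , a , r′) with reach-sound k y r′
  ...   | l , l≤k , w = suc l , s≤s l≤k , step a w

  reach-complete : ∀ {x l} → Walk G x j l → reach l x ≡ true
  reach-complete here       = reach-root 0
  reach-complete {l = suc l} (step a w) = reach-step {l} a (reach-complete w)

  fresh⇒notClosed : ∀ {k y} → reach (suc k) y ≡ true → reach k y ≡ false →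
                    ¬ ClosedSet G (reach k)
  fresh⇒notClosed {k} r₁ r₀ closed with reach-suc-cases {k} r₁
  ... | inj₁ r              with () ← trans (sym r) r₀
  ... | inj₂ (z , a , rz)   with () ← trans (sym (closed _ z a rz)) r₀

  closedOrGrowing : ∀ k → ClosedSet G (reach k) ⊎ suc k ≤ count (reach k)
  closedOrGrowing zero = inj₂ (count-≥1 (reach 0) j (reach-root 0))
  closedOrGrowing (suc k)
    with any? (λ y → (reach (suc k) y ≟ᵇ true) ×-dec (reach k y ≟ᵇ false))
  ... | no noneFresh = inj₁ λ x y a r → reach-step {k} a (stable y r)
    where
      stable : ∀ y → reach (suc k) y ≡ true → reach k y ≡ true
      stable y r with reach k y ≟ᵇ false
      ... | yes r₀ = ⊥-elim (noneFresh (y , r , r₀))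
      ... | no ¬r₀ = ¬-not ¬r₀
  ... | yes (y , r₁ , r₀) with closedOrGrowing k
  ...   | inj₁ closed = ⊥-elim (fresh⇒notClosed {k} r₁ r₀ closed)
  ...   | inj₂ big    =
    inj₂ (≤-trans (s≤s big) (count-strict (reach k) (reach (suc k)) (λ x → reach-suc {k}) y r₀ r₁))

  reach-closed : ClosedSet G (reach n)
  reach-closed with closedOrGrowing n
  ... | inj₁ closed = closed
  ... | inj₂ big    = ⊥-elim (1+n≰n (≤-trans big (count-≤ (reach n))))

  module Distances (reachesAll : ∀ x → reach n x ≡ true) where
    open import Data.Nat using (_+_; _<_; _<?_) renaming (_≟_ to _≟ℕ_)
    open import Data.Nat.Properties
      using (≤-antisym; ≤-refl; ≤-reflexive; <⇒≤; ≰⇒>; n≤0⇒n≡0; _≤?_; <-cmp)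
    open import Relation.Binary.Definitions using (tri<; tri≈; tri>)
    open import Relation.Nullary.Decidable using (dec-false)

    δ : Fin n → ℕ
    δ x = least (λ k → reach k x) n

    δ-reach : ∀ x → reach (δ x) x ≡ true
    δ-reach x = proj₁ (least-spec (λ k → reach k x) n n (reachesAll x) ≤-refl)

    δ-≤n : ∀ x → δ x ≤ n
    δ-≤n x = least-≤ (λ k → reach k x) n

    δ-≤ : ∀ {k x} → reach k x ≡ true → δ x ≤ k
    δ-≤ {k} {x} r with k ≤? n
    ... | yes k≤n = proj₂ (least-spec (λ k → reach k x) n k r k≤n)
    ... | no  k≰n = ≤-trans (least-≤ (λ k → reach k x) n) (<⇒≤ (≰⇒> k≰n))

    δ-walk : ∀ x → Walk G x j (δ x)
    δ-walk x with reach-sound (δ x) x (δ-reach x)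
    ... | l , l≤δ , w = subst (Walk G x j) (≤-antisym l≤δ (δ-≤ (reach-complete w))) w

    δ-minimal : ∀ {x l} → Walk G x j l → δ x ≤ l
    δ-minimal w = δ-≤ (reach-complete w)

    δ-root : δ j ≡ 0
    δ-root = n≤0⇒n≡0 (δ-≤ {0} (reach-root 0))

    δ≡0⇒root : ∀ {x} → δ x ≡ 0 → x ≡ j
    δ≡0⇒root {x} δx≡0 with x ≟ j
    ... | yes x≡j = x≡j
    ... | no  x≢j with () ← trans (sym (subst (λ k → reach k x ≡ true) δx≡0 (δ-reach x)))
                                  (dec-false (x ≟ j) x≢j)

    δ-edge : ∀ {x y} → Adj G x y ≡ true → δ x ≤ suc (δ y)
    δ-edge {x} {y} a = δ-≤ (reach-step {δ y} a (δ-reach y))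

    δ-parent : ∀ {x} → x ≢ j → Σ (Fin n) λ y → (Adj G x y ≡ true) × (suc (δ y) ≡ δ x)
    δ-parent {x} x≢j with δ x in δx
    ... | zero  = ⊥-elim (x≢j (δ≡0⇒root δx))
    ... | suc k with reach-suc-cases {k} (subst (λ m → reach m x ≡ true) δx (δ-reach x))
    ...   | inj₁ r with () ← trans (sym r)
                               (least-minimal (λ k → reach k x) n k (≤-reflexive (sym δx)))
    ...   | inj₂ (y , a , r) = y , a , ≤-antisym (s≤s (δ-≤ r)) (subst (_≤ suc (δ y)) δx (δ-edge a))

    drop-by-one : ∀ {x y} → Adj G x y ≡ true → δ y < δ x → suc (δ y) ≡ δ x
    drop-by-one a δy<δx = ≤-antisym δy<δx (δ-edge a)

    lower level higher : Fin n → Fin n → Bool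
    lower  x y = Adj G x y ∧ does (δ y <? δ x)
    level  x y = Adj G x y ∧ does (δ y ≟ℕ δ x)
    higher x y = Adj G x y ∧ does (δ x <? δ y)

    indicator-split : ∀ x y → indicator (Adj G x y)
      ≡ indicator (lower x y) + indicator (level x y) + indicator (higher x y)
    indicator-split x y with Adj G x y
    ... | false = refl
    ... | true with <-cmp (δ y) (δ x)
    ...   | tri< lt ¬eq ¬gt rewrite dec-true (δ y <? δ x) lt | dec-false (δ y ≟ℕ δ x) ¬eq
                                  | dec-false (δ x <? δ y) ¬gt = refl
    ...   | tri≈ ¬lt eq ¬gt rewrite dec-false (δ y <? δ x) ¬lt | dec-true (δ y ≟ℕ δ x) eq
                                  | dec-false (δ x <? δ y) ¬gt = refl
    ...   | tri> ¬lt ¬eq gt rewrite dec-false (δ y <? δ x) ¬lt | dec-false (δ y ≟ℕ δ x) ¬eq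
                                  | dec-true (δ x <? δ y) gt = refl

    module TreeLevels (degreeSum : 2 + ∑ℕ (degree G) ≡ n * 2) where
      open import Data.Nat.Properties using (m≤m+n; m≤n+m; *-identityʳ; 1+n≰n)

      #lower #level #higher : Fin n → ℕ
      #lower  x = count (lower x)
      #level  x = count (level x)
      #higher x = count (higher x)

      degree-split : ∀ x → degree G x ≡ #lower x + #level x + #higher x
      degree-split x = trans (∑ℕ-cong (indicator-split x))
        (trans (∑ℕ-+ (λ y → [lower] y + [level] y) [higher])
               (cong (_+ #higher x) (∑ℕ-+ [lower] [level])))
        where
          [lower] [level] [higher] : Fin n → ℕ
          [lower]  y = indicator (lower x y)
          [level]  y = indicator (level x y)
          [higher] y = indicator (higher x y)

      -- each edge between levels is counted once from either end
      ∑higher≡∑lower : ∑ℕ #higher ≡ ∑ℕ #lower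
      ∑higher≡∑lower = trans (∑ℕ-swap (λ x y → indicator (higher x y)))
        (∑ℕ-cong λ y → ∑ℕ-cong λ x → cong (λ b → indicator (b ∧ does (δ x <? δ y))) (symmetric G x y))

      ∑degree : ∑ℕ (degree G) ≡ ∑ℕ #lower + ∑ℕ #level + ∑ℕ #lower
      ∑degree = trans (∑ℕ-cong degree-split)
        (trans (∑ℕ-+ (λ x → #lower x + #level x) #higher)
               (cong₂ _+_ (∑ℕ-+ #lower #level) ∑higher≡∑lower))

      isRoot : Fin n → ℕ
      isRoot x = indicator (does (x ≟ j))

      ∑isRoot : ∑ℕ isRoot ≡ 1
      ∑isRoot = trans (∑ℕ-single isRoot j (λ x x≢j → cong indicator (dec-false (x ≟ j) x≢j)))
                      (cong indicator (dec-true (j ≟ j) refl))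

      lower-or-root : ∀ x → 1 ≤ #lower x + isRoot x
      lower-or-root x with x ≟ j
      ... | yes _   = m≤n+m 1 (#lower x)
      ... | no  x≢j with δ-parent x≢j
      ...   | y , a , parent =
        ≤-trans (count-≥1 (lower x) y (∧-join a (dec-true (δ y <? δ x) (≤-reflexive parent))))
                (m≤m+n (#lower x) 0)

      n≡∑1 : n ≡ ∑ℕ {n} (λ _ → 1)
      n≡∑1 = sym (trans (∑ℕ-const n 1) (*-identityʳ n))

      ∑lower-or-root : ∑ℕ (λ x → #lower x + isRoot x) ≡ ∑ℕ #lower + 1
      ∑lower-or-root = trans (∑ℕ-+ #lower isRoot) (cong (∑ℕ #lower +_) ∑isRoot)

      -- 2 + (2·#lower + #level) = 2n together with n ≤ #lower + 1 (each
      -- non-root vertex has a lower neighbour) forces #level = 0, #lower = n − 1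
      counting : ∑ℕ #level ≡ 0 × ∑ℕ #lower + 1 ≡ n
      counting = twiceCount (∑ℕ #lower) (∑ℕ #level) n
        (trans (cong (2 +_) (sym ∑degree)) degreeSum)
        (subst (_≤ ∑ℕ #lower + 1) (sym n≡∑1)
          (≤-trans (∑ℕ-mono lower-or-root) (≤-reflexive ∑lower-or-root)))

      lower-or-root-exact : ∀ x → #lower x + isRoot x ≡ 1
      lower-or-root-exact x = sym (∑ℕ-tight lower-or-root (≤-reflexive (begin
        ∑ℕ (λ x → #lower x + isRoot x)   ≡⟨ ∑lower-or-root ⟩
        ∑ℕ #lower + 1                    ≡⟨ proj₂ counting ⟩
        n                                ≡⟨ n≡∑1 ⟩
        ∑ℕ {n} (λ _ → 1)                 ∎)) x)
        where open ≡-Reasoning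

      #level≡0 : ∀ x → #level x ≡ 0
      #level≡0 x = sym (∑ℕ-tight {g = #level} (λ _ → z≤n)
        (≤-reflexive (trans (proj₁ counting) (sym (∑ℕ-0 n)))) x)

      no-level-edge : ∀ {x y} → Adj G x y ≡ true → δ x ≢ δ y
      no-level-edge {x} {y} a δx≡δy = 1+n≰n (≤-trans
        (count-≥1 (level x) y (∧-join a (dec-true (δ y ≟ℕ δ x) (sym δx≡δy))))
        (≤-reflexive (#level≡0 x)))

      unique-lower : ∀ {x y z} → Adj G x y ≡ true → Adj G x z ≡ true →
                     δ y < δ x → δ z < δ x → y ≡ z
      unique-lower {x} {y} {z} ay az δy<δx δz<δx with y ≟ z
      ... | yes y≡z = y≡z
      ... | no  y≢z = ⊥-elim (1+n≰n (≤-trans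
        (count-≥2 (lower x) y z (∧-join ay (dec-true (δ y <? δ x) δy<δx))
                                (∧-join az (dec-true (δ z <? δ x) δz<δx)) y≢z)
        (≤-trans (m≤m+n (#lower x) (isRoot x)) (≤-reflexive (lower-or-root-exact x)))))

      neighbour-levels : ∀ {x y} → Adj G x y ≡ true → suc (δ y) ≡ δ x ⊎ δ y ≡ suc (δ x)
      neighbour-levels {x} {y} a with <-cmp (δ y) (δ x)
      ... | tri< δy<δx _ _ = inj₁ (drop-by-one a δy<δx)
      ... | tri≈ _ δy≡δx _ = ⊥-elim (no-level-edge a (sym δy≡δx))
      ... | tri> _ _ δx<δy = inj₂ (sym (drop-by-one (trans (symmetric G y x) a) δx<δy))

-- A graph carrying a vertex potential h such that no edge joins two vertices
-- of equal potential and no vertex has two neighbours of smaller potential is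
-- acyclic: the vertex of a cycle with the largest potential would have two
-- distinct cycle-neighbours, both of smaller potential.
module Cycles where
  open import Data.Nat using (ℕ; zero; suc; _≤_; _<_; _≤?_)
  open import Data.Nat.Properties using (≤-refl; ≤-trans; <⇒≤; ≰⇒>; ≤∧≢⇒<)
  open import Data.Fin using (zero; suc; inject₁; fromℕ)
  open import Data.Fin.Properties using (suc-injective)
  open import Data.Product using (Σ; _×_; _,_)
  open import Relation.Nullary using (yes; no)
  open import Relation.Binary.PropositionalEquality

  argmax : ∀ {p} (g : Fin (suc p) → ℕ) → Σ (Fin (suc p)) λ t → ∀ s → g s ≤ g t
  argmax {zero}  g = zero , λ { zero → ≤-refl }
  argmax {suc p} g with argmax (λ k → g (suc k))
  ... | t , max with g zero ≤? g (suc t)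
  ...   | yes g0≤ = suc t , λ { zero → g0≤ ; (suc s) → max s }
  ...   | no  g0≰ = zero  , λ { zero → ≤-refl ; (suc s) → ≤-trans (max s) (<⇒≤ (≰⇒> g0≰)) }

  data LastOrInject {K : ℕ} : Fin (suc K) → Set where
    last   : LastOrInject (fromℕ K)
    inject : ∀ s → LastOrInject (inject₁ s)

  lastOrInject : ∀ {K} (t : Fin (suc K)) → LastOrInject t
  lastOrInject {zero}  zero    = last
  lastOrInject {suc K} zero    = inject zero
  lastOrInject {suc K} (suc t) with lastOrInject t
  ... | last     = last
  ... | inject s = inject (suc s)

  twoAhead≢ : ∀ {K} (s : Fin K) → suc (suc s) ≢ inject₁ (inject₁ s)
  twoAhead≢ zero    ()
  twoAhead≢ (suc s) e = twoAhead≢ s (suc-injective e)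

  module _ {n} {G : SimpleGraph n} (c : Cycle G) where
    open Cycle c

    cycleNeighbours : ∀ t → Σ (Fin (suc (suc (suc m)))) λ u → Σ (Fin (suc (suc (suc m)))) λ w →
      (Adj G (v t) (v u) ≡ true) × (Adj G (v t) (v w) ≡ true) × u ≢ w
    cycleNeighbours zero =
      suc zero , fromℕ (suc (suc m)) , edges zero , trans (symmetric G _ _) closing , λ ()
    cycleNeighbours (suc s) with lastOrInject s
    ... | last      = zero , inject₁ s , closing , trans (symmetric G _ _) (edges s) , λ ()
    ... | inject s′ =
      suc (suc s′) , inject₁ s , edges (suc s′) , trans (symmetric G _ _) (edges s) , twoAhead≢ s′

  acyclic-by-potential : ∀ {n} (G : SimpleGraph n) (h : Fin n → ℕ) →
    (∀ {x y} → Adj G x y ≡ true → h x ≢ h y) →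
    (∀ {x y z} → Adj G x y ≡ true → Adj G x z ≡ true → h y < h x → h z < h x → y ≡ z) →
    Acyclic G
  acyclic-by-potential G h no-level-edge unique-lower c with argmax (λ k → h (Cycle.v c k))
  ... | t , max with cycleNeighbours c t
  ...   | u , w , au , aw , u≢w =
    u≢w (distinct (unique-lower au aw (below au (max u)) (below aw (max w))))
    where
      open Cycle c
      below : ∀ {y} → Adj G (v t) y ≡ true → h y ≤ h (v t) → h y < h (v t)
      below a hy≤ = ≤∧≢⇒< hy≤ (λ e → no-level-edge a (sym e))

module RingSums {c ℓ} (R : CommutativeRing c ℓ) where
  open CommutativeRing R hiding (zero)
  open import Algebra.Properties.Semiring.Sum semiring
    using (sum; sum-cong-≋; ∑-distrib-+; ∑-comm; *-distribˡ-sum; *-distribʳ-sum; sum-replicate-zero)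
  open import Algebra.Properties.Ring ring using (-1*x≈-x; +-cancelˡ)
  open import Data.Nat using (ℕ; zero; suc) renaming (_+_ to _+ℕ_)
  open import Data.Fin using (zero; suc; _≟_)
  open import Relation.Nullary using (does)
  open import Relation.Nullary.Decidable using (dec-true; dec-false)
  open import Data.Fin.Properties using (suc-injective)
  open import Data.Bool using (false; if_then_else_)
  open import Data.Empty using (⊥-elim)
  open import Relation.Binary.PropositionalEquality as ≡ using (_≢_)
  open import Relation.Binary.Reasoning.Setoid setoid
  open NatSums using (indicator)

  ∑≡sum : ∀ {n} (f : Fin n → Carrier) → ∑ R f ≡ sum f
  ∑≡sum {zero}  f = ≡.refl
  ∑≡sum {suc n} f = ≡.cong (f zero +_) (∑≡sum (λ k → f (suc k)))

  ∑-cong : ∀ {n} {f g : Fin n → Carrier} → (∀ k → f k ≈ g k) → ∑ R f ≈ ∑ R g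
  ∑-cong {f = f} {g} f≈g rewrite ∑≡sum f | ∑≡sum g = sum-cong-≋ f≈g

  ∑-+ : ∀ {n} (f g : Fin n → Carrier) → ∑ R (λ k → f k + g k) ≈ ∑ R f + ∑ R g
  ∑-+ f g rewrite ∑≡sum (λ k → f k + g k) | ∑≡sum f | ∑≡sum g = ∑-distrib-+ f g

  ∑-*ˡ : ∀ {n} a (f : Fin n → Carrier) → ∑ R (λ k → a * f k) ≈ a * ∑ R f
  ∑-*ˡ a f rewrite ∑≡sum (λ k → a * f k) | ∑≡sum f = sym (*-distribˡ-sum a f)

  ∑-*ʳ : ∀ {n} a (f : Fin n → Carrier) → ∑ R (λ k → f k * a) ≈ ∑ R f * a
  ∑-*ʳ a f rewrite ∑≡sum (λ k → f k * a) | ∑≡sum f = sym (*-distribʳ-sum a f)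

  ∑-0 : ∀ n → ∑ R {n} (λ _ → 0#) ≈ 0#
  ∑-0 n rewrite ∑≡sum {n} (λ _ → 0#) = sum-replicate-zero n

  ∑-swap : ∀ {m n} (f : Fin m → Fin n → Carrier) →
           ∑ R (λ i → ∑ R (f i)) ≈ ∑ R (λ k → ∑ R (λ i → f i k))
  ∑-swap {zero}  {n} f = sym (∑-0 n)
  ∑-swap {suc m}     f = trans (+-congˡ (∑-swap (λ i → f (suc i))))
                               (sym (∑-+ (f zero) (λ k → ∑ R (λ i → f (suc i) k))))

  ∑-neg : ∀ {n} (f : Fin n → Carrier) → ∑ R (λ k → - f k) ≈ - ∑ R f
  ∑-neg f = begin
    ∑ R (λ k → - f k)        ≈⟨ ∑-cong (λ k → sym (-1*x≈-x (f k))) ⟩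
    ∑ R (λ k → - 1# * f k)   ≈⟨ ∑-*ˡ (- 1#) f ⟩
    - 1# * ∑ R f             ≈⟨ -1*x≈-x _ ⟩
    - ∑ R f                  ∎

  ∑-- : ∀ {n} (f g : Fin n → Carrier) → ∑ R (λ k → f k - g k) ≈ ∑ R f - ∑ R g
  ∑-- f g = trans (∑-+ f (λ k → - g k)) (+-congˡ (∑-neg g))

  ∑-single : ∀ {n} (f : Fin n → Carrier) y → (∀ x → x ≢ y → f x ≈ 0#) → ∑ R f ≈ f y
  ∑-single {suc n} f zero    vanish =
    trans (+-congˡ (trans (∑-cong (λ k → vanish (suc k) (λ ()))) (∑-0 n))) (+-identityʳ _)
  ∑-single {suc n} f (suc y) vanish =
    trans (+-congʳ (vanish zero (λ ())))
          (trans (+-identityˡ _)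
                 (∑-single (λ k → f (suc k)) y (λ x x≢y → vanish (suc x) (λ e → x≢y (suc-injective e)))))

  χ : Bool → Carrier
  χ b = if b then 1# else 0#

  ι-+ : ∀ a b → ι R (a +ℕ b) ≈ ι R a + ι R b
  ι-+ zero    b = sym (+-identityˡ _)
  ι-+ (suc a) b = trans (+-congˡ (ι-+ a b)) (sym (+-assoc 1# (ι R a) (ι R b)))

  ι-∑ℕ : ∀ {n} (f : Fin n → ℕ) → ι R (∑ℕ f) ≈ ∑ R (λ k → ι R (f k))
  ι-∑ℕ {zero}  f = refl
  ι-∑ℕ {suc n} f = trans (ι-+ (f zero) _) (+-congˡ (ι-∑ℕ (λ k → f (suc k))))

  ι-indicator : ∀ b → ι R (indicator b) ≈ χ b
  ι-indicator true  = +-identityʳ 1#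
  ι-indicator false = refl

  ι-injective : CharZero R → ∀ a b → ι R a ≈ ι R b → a ≡ b
  ι-injective char0 zero    zero    e = ≡.refl
  ι-injective char0 zero    (suc b) e = ⊥-elim (char0 b (sym e))
  ι-injective char0 (suc a) zero    e = ⊥-elim (char0 a e)
  ι-injective char0 (suc a) (suc b) e = ≡.cong suc (ι-injective char0 a b (+-cancelˡ 1# _ _ e))

  diagonal : ∀ {n} → (Fin n → Carrier) → Matrix R n
  diagonal a i k = if does (i ≟ k) then a i else 0#

  diagonal-off : ∀ {n} (a : Fin n → Carrier) {i k} → i ≢ k → diagonal a i k ≡ 0#
  diagonal-off a {i} {k} i≢k rewrite dec-false (i ≟ k) i≢k = ≡.refl

  diagonal-on : ∀ {n} (a : Fin n → Carrier) k → diagonal a k k ≡ a k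
  diagonal-on a k rewrite dec-true (k ≟ k) ≡.refl = ≡.refl

  ∑-diagonalʳ : ∀ {n} (g a : Fin n → Carrier) k → ∑ R (λ i → g i * diagonal a i k) ≈ g k * a k
  ∑-diagonalʳ g a k = trans
    (∑-single _ k (λ i i≢k → trans (*-congˡ (reflexive (diagonal-off a i≢k))) (zeroʳ (g i))))
    (*-congˡ (reflexive (diagonal-on a k)))

  ∑-diagonalˡ : ∀ {n} (a g : Fin n → Carrier) x → ∑ R (λ k → diagonal a x k * g k) ≈ a x * g x
  ∑-diagonalˡ a g x = trans
    (∑-single _ x (λ k k≢x → trans (*-congʳ (reflexive (diagonal-off a (λ e → k≢x (≡.sym e)))))
                                   (zeroˡ (g k))))
    (*-congʳ (reflexive (diagonal-on a x)))

module IdentityConsequences {c ℓ} (R : CommutativeRing c ℓ) {n} (G : SimpleGraph n)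
                            (D : Matrix R n) (identity : LaplacianIdentity R G D) where
  open CommutativeRing R hiding (zero)
  open RingSums R
  open NatSums using (indicator; ∑ℕ-const)
  open ClosedSets
  open import Algebra.Properties.Ring ring using (x[y-z]≈xy-xz; [y-z]x≈yx-zx; //-rightDividesˡ)
  open import Data.Nat using () renaming (_+_ to _+ℕ_; _*_ to _*ℕ_)
  open import Data.Bool using (false)
  open import Data.Empty using (⊥-elim)
  import Relation.Binary.PropositionalEquality as ≡
  open ≡ using (_≢_)
  open import Relation.Binary.Reasoning.Setoid setoid

  A L LD : Matrix R n
  A  = adjMat R G
  L  = laplacian R G
  LD = _⊗_ R L D

  d : Fin n → Carrier
  d i = ι R (degree G i)

  d≈rowSum : ∀ i → d i ≈ ∑ R (A i)
  d≈rowSum i = trans (ι-∑ℕ (λ k → indicator (Adj G i k))) (∑-cong (λ k → ι-indicator (Adj G i k)))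

  sub-add : ∀ a b → (a - b) + b ≈ a
  sub-add a b = //-rightDividesˡ b a

  module Closed (S : Fin n → Bool) (closed : ClosedSet G S) where

    -- χ_S A is symmetric, since an edge never leaves S
    χA-symmetric : ∀ i k → χ (S i) * A i k ≈ χ (S k) * A k i
    χA-symmetric i k rewrite symmetric G i k with Adj G k i in a
    ... | false = trans (zeroʳ _) (sym (zeroʳ _))
    ... | true  rewrite closed-same G S closed (≡.trans (symmetric G i k) a) = refl

    χL≈0 : ∀ k → ∑ R (λ i → χ (S i) * L i k) ≈ 0#
    χL≈0 k = begin
      ∑ R (λ i → χ (S i) * L i k)
        ≈⟨ ∑-cong (λ i → x[y-z]≈xy-xz (χ (S i)) _ (A i k)) ⟩
      ∑ R (λ i → χ (S i) * diagonal d i k - χ (S i) * A i k)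
        ≈⟨ ∑-- (λ i → χ (S i) * diagonal d i k) (λ i → χ (S i) * A i k) ⟩
      ∑ R (λ i → χ (S i) * diagonal d i k) - ∑ R (λ i → χ (S i) * A i k)
        ≈⟨ +-cong (∑-diagonalʳ (λ i → χ (S i)) d k) (-‿cong adjacencyPart) ⟩
      χ (S k) * d k - χ (S k) * d k
        ≈⟨ -‿inverseʳ _ ⟩
      0# ∎
      where
      adjacencyPart : ∑ R (λ i → χ (S i) * A i k) ≈ χ (S k) * d k
      adjacencyPart = begin
        ∑ R (λ i → χ (S i) * A i k) ≈⟨ ∑-cong (λ i → χA-symmetric i k) ⟩
        ∑ R (λ i → χ (S k) * A k i) ≈⟨ ∑-*ˡ (χ (S k)) (A k) ⟩
        χ (S k) * ∑ R (A k)         ≈⟨ *-congˡ (sym (d≈rowSum k)) ⟩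
        χ (S k) * d k               ∎

    χLD≈0 : ∀ j → ∑ R (λ i → χ (S i) * LD i j) ≈ 0#
    χLD≈0 j = begin
      ∑ R (λ i → χ (S i) * LD i j)
        ≈⟨ ∑-cong (λ i → trans (sym (∑-*ˡ (χ (S i)) (λ k → L i k * D k j)))
                               (∑-cong (λ k → sym (*-assoc (χ (S i)) (L i k) (D k j))))) ⟩
      ∑ R (λ i → ∑ R (λ k → (χ (S i) * L i k) * D k j))
        ≈⟨ ∑-swap (λ i k → (χ (S i) * L i k) * D k j) ⟩
      ∑ R (λ k → ∑ R (λ i → (χ (S i) * L i k) * D k j))
        ≈⟨ ∑-cong (λ k → trans (∑-*ʳ (D k j) (λ i → χ (S i) * L i k))
                               (trans (*-congʳ (χL≈0 k)) (zeroˡ _))) ⟩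
      ∑ R {n} (λ _ → 0#)
        ≈⟨ ∑-0 n ⟩
      0# ∎

    χ2I : ∀ j → ∑ R (λ i → χ (S i) * (ι R 2 * idMat R i j)) ≈ χ (S j) * ι R 2
    χ2I j = begin
      ∑ R (λ i → χ (S i) * (ι R 2 * idMat R i j))
        ≈⟨ ∑-cong (λ i → sym (*-assoc (χ (S i)) (ι R 2) (idMat R i j))) ⟩
      ∑ R (λ i → (χ (S i) * ι R 2) * diagonal (λ _ → 1#) i j)
        ≈⟨ ∑-diagonalʳ (λ i → χ (S i) * ι R 2) (λ _ → 1#) j ⟩
      (χ (S j) * ι R 2) * 1#
        ≈⟨ *-identityʳ _ ⟩
      χ (S j) * ι R 2 ∎

    -- χ_S times the right-hand side (2·1 − d)1ᵀ: the same in every column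
    rhs : Carrier
    rhs = ∑ R (λ i → χ (S i) * ((ι R 2 - d i) * 1#))

    component-identity : ∀ j → χ (S j) * ι R 2 ≈ rhs
    component-identity j = begin
      χ (S j) * ι R 2
        ≈⟨ sym (+-identityˡ _) ⟩
      0# + χ (S j) * ι R 2
        ≈⟨ sym (+-cong (χLD≈0 j) (χ2I j)) ⟩
      ∑ R (λ i → χ (S i) * LD i j) + ∑ R (λ i → χ (S i) * (ι R 2 * idMat R i j))
        ≈⟨ sym (∑-+ (λ i → χ (S i) * LD i j) (λ i → χ (S i) * (ι R 2 * idMat R i j))) ⟩
      ∑ R (λ i → χ (S i) * LD i j + χ (S i) * (ι R 2 * idMat R i j))
        ≈⟨ ∑-cong (λ i → trans (sym (distribˡ _ _ _)) (*-congˡ (identity i j))) ⟩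
      rhs ∎

  -- In characteristic zero a closed set containing one vertex contains all of
  -- them: otherwise 1·2 = rhs = 0·2.
  closed-full : CharZero R → (S : Fin n → Bool) → ClosedSet G S →
                ∀ {j} → S j ≡ true → ∀ x → S x ≡ true
  closed-full char0 S closed {j} Sj x with S x in Sx
  ... | true  = ≡.refl
  ... | false = ⊥-elim (char0 1 (begin
      ι R 2            ≈⟨ sym (*-identityˡ _) ⟩
      1# * ι R 2       ≈⟨ at j Sj ⟩
      rhs              ≈⟨ sym (at x Sx) ⟩
      0# * ι R 2       ≈⟨ zeroˡ _ ⟩
      0# ∎))
    where
      open Closed S closed
      at : ∀ y {b} → S y ≡ b → χ b * ι R 2 ≈ rhs
      at y Sy = ≡.subst (λ b → χ b * ι R 2 ≈ rhs) Sy (component-identity y)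

  -- With S the whole vertex set: 2 = ∑ (2 − d_i), i.e. ∑ d_i = 2n − 2.
  degree-sum : CharZero R → Fin n → 2 +ℕ ∑ℕ (degree G) ≡ n *ℕ 2
  degree-sum char0 j = ≡.trans (ι-injective char0 _ _ (begin
      ι R (2 +ℕ ∑ℕ (degree G))            ≈⟨ ι-+ 2 (∑ℕ (degree G)) ⟩
      ι R 2 + ι R (∑ℕ (degree G))         ≈⟨ +-cong two≈∑ (ι-∑ℕ (degree G)) ⟩
      ∑ R (λ i → ι R 2 - d i) + ∑ R d     ≈⟨ sym (∑-+ (λ i → ι R 2 - d i) d) ⟩
      ∑ R (λ i → (ι R 2 - d i) + d i)     ≈⟨ ∑-cong (λ i → sub-add (ι R 2) (d i)) ⟩
      ∑ R {n} (λ _ → ι R 2)               ≈⟨ sym (ι-∑ℕ {n} (λ _ → 2)) ⟩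
      ι R (∑ℕ {n} (λ _ → 2))              ∎))
    (∑ℕ-const n 2)
    where
      open Closed (λ _ → true) (λ _ _ _ _ → ≡.refl)
      two≈∑ : ι R 2 ≈ ∑ R (λ i → ι R 2 - d i)
      two≈∑ = trans (sym (*-identityˡ _))
        (trans (component-identity j)
               (∑-cong (λ i → trans (*-identityˡ ((ι R 2 - d i) * 1#)) (*-identityʳ (ι R 2 - d i)))))

  row-identity : ∀ {x j} → x ≢ j → ∑ R (λ k → A x k * ((D x j - D k j) + 1#)) ≈ ι R 2
  row-identity {x} {j} x≢j = begin
    ∑ R (λ k → A x k * ((D x j - D k j) + 1#))
      ≈⟨ ∑-cong (λ k → trans (distribˡ (A x k) _ 1#)
                              (+-cong (x[y-z]≈xy-xz (A x k) (D x j) (D k j)) (*-identityʳ _))) ⟩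
    ∑ R (λ k → (A x k * D x j - A x k * D k j) + A x k)
      ≈⟨ ∑-+ (λ k → A x k * D x j - A x k * D k j) (A x) ⟩
    ∑ R (λ k → A x k * D x j - A x k * D k j) + ∑ R (A x)
      ≈⟨ +-cong (∑-- (λ k → A x k * D x j) (λ k → A x k * D k j)) (sym (d≈rowSum x)) ⟩
    (∑ R (λ k → A x k * D x j) - ∑ R (λ k → A x k * D k j)) + d x
      ≈⟨ +-congʳ (+-congʳ (trans (∑-*ʳ (D x j) (A x)) (*-congʳ (sym (d≈rowSum x))))) ⟩
    (d x * D x j - ∑ R (λ k → A x k * D k j)) + d x
      ≈⟨ +-congʳ (sym LDx≈) ⟩
    LD x j + d x
      ≈⟨ +-congʳ LDxj≈ ⟩
    (ι R 2 - d x) + d x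
      ≈⟨ sub-add _ _ ⟩
    ι R 2 ∎
    where
      LDx≈ : LD x j ≈ d x * D x j - ∑ R (λ k → A x k * D k j)
      LDx≈ = trans (∑-cong (λ k → [y-z]x≈yx-zx (D k j) (diagonal d x k) (A x k)))
               (trans (∑-- (λ k → diagonal d x k * D k j) (λ k → A x k * D k j))
                      (+-congʳ (∑-diagonalˡ d (λ k → D k j) x)))
      -- off the diagonal, LD x j + 2·0 = (2 − d x)·1
      LDxj≈ : LD x j ≈ ι R 2 - d x
      LDxj≈ = trans (sym (+-identityʳ _))
        (trans (+-congˡ (sym (trans (*-congˡ (reflexive (diagonal-off (λ _ → 1#) x≢j))) (zeroʳ _))))
               (trans (identity x j) (*-identityʳ _)))

module FromRoot {c ℓ} (R : CommutativeRing c ℓ) (char0 : CharZero R) {n} (G : SimpleGraph n)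
                (D : Matrix R n) (identity : LaplacianIdentity R G D) (j : Fin n) where
  open CommutativeRing R hiding (zero)
  open RingSums R
  open IdentityConsequences R G D identity
  open Levels G j public using (reach; reach-closed; reach-root)
  open Levels.Distances G j (closed-full char0 (reach n) reach-closed (reach-root n)) public
  open TreeLevels (degree-sum char0 j) public
  open import Algebra.Properties.Ring ring using (⁻¹-anti-homo‿-; +-cancelʳ)
  open import Data.Nat using (zero; suc) renaming (_+_ to _+ℕ_)
  open import Data.Nat.Properties using (≤-trans; ≤-reflexive; 1+n≰n; +-suc; suc-injective; m≤m+n)
  open import Data.Bool using (if_then_else_)
  open import Data.Sum using (inj₁; inj₂)
  open import Data.Empty using (⊥-elim)
  import Relation.Binary.PropositionalEquality as ≡
  open ≡ using (_≢_)
  open import Relation.Binary.Reasoning.Setoid setoid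

  not-root : ∀ {x m} → δ x ≡ suc m → x ≢ j
  not-root δx≡ ≡.refl with () ← ≡.trans (≡.sym δ-root) δx≡

  flip-one : ∀ a b → a - b ≈ 1# → (b - a) + 1# ≈ 0#
  flip-one a b a-b≈1 = begin
    (b - a) + 1#       ≈⟨ +-congʳ (sym (⁻¹-anti-homo‿- a b)) ⟩
    - (a - b) + 1#     ≈⟨ +-congʳ (-‿cong a-b≈1) ⟩
    - 1# + 1#          ≈⟨ -‿inverseˡ 1# ⟩
    0#                 ∎

  plus-one≈two : ∀ u → u + 1# ≈ ι R 2 → u ≈ 1#
  plus-one≈two u e = +-cancelʳ 1# u 1# (trans e (+-congˡ (+-identityʳ 1#)))

  module Column (zeroDiagonal : ZeroDiagonal R D) where

    -- Downward induction on δ x, run on a fuel t with n < t + δ x: in row x of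
    -- the identity, every neighbour other than y lies one level higher and so
    -- (by induction) contributes 0, leaving (D x j − D y j) + 1 = 2.
    parent-step : ∀ t {x y} → Adj G x y ≡ true → suc (δ y) ≡ δ x → suc n ≤ t +ℕ δ x →
                  D x j - D y j ≈ 1#
    parent-step zero    {x} a parent fuel = ⊥-elim (1+n≰n (≤-trans fuel (δ-≤n x)))
    parent-step (suc t) {x} {y} a parent fuel =
      plus-one≈two _ (trans (sym only-parent) (row-identity (not-root (≡.sym parent))))
      where
        term : Fin n → Carrier
        term k = adjMat R G x k * ((D x j - D k j) + 1#)

        child-step : ∀ {k} → Adj G x k ≡ true → δ k ≡ suc (δ x) → (D x j - D k j) + 1# ≈ 0#
        child-step {k} ak child = flip-one (D k j) (D x j)
          (parent-step t (≡.trans (symmetric G k x) ak) (≡.sym child) (≤-trans fuel (≤-reflexive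
            (≡.trans (≡.sym (+-suc t (δ x))) (≡.cong (t +ℕ_) (≡.sym child))))))

        others-vanish : ∀ k → k ≢ y → term k ≈ 0#
        others-vanish k k≢y with Adj G x k in ak
        ... | false = zeroˡ _
        ... | true with neighbour-levels ak
        ...   | inj₁ kParent =
          ⊥-elim (k≢y (unique-lower ak a (≤-reflexive kParent) (≤-reflexive parent)))
        ...   | inj₂ child   = trans (*-identityˡ _) (child-step ak child)

        only-parent : ∑ R term ≈ (D x j - D y j) + 1#
        only-parent = trans (∑-single term y others-vanish)
          (≡.subst (λ b → (if b then 1# else 0#) * ((D x j - D y j) + 1#) ≈ (D x j - D y j) + 1#)
                   (≡.sym a) (*-identityˡ _))

    column : ∀ m x → δ x ≡ m → D x j ≈ ι R m
    column zero    x δx≡0 with δ≡0⇒root δx≡0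
    ... | ≡.refl = zeroDiagonal j
    column (suc m) x δx≡ with δ-parent (not-root δx≡)
    ... | y , a , parent = begin
      D x j                     ≈⟨ sym (sub-add (D x j) (D y j)) ⟩
      (D x j - D y j) + D y j   ≈⟨ +-congʳ (parent-step (suc n) a parent (m≤m+n (suc n) (δ x))) ⟩
      1# + D y j                ≈⟨ +-congˡ (column m y (suc-injective (≡.trans parent δx≡))) ⟩
      ι R (suc m)               ∎

corollary1 : {c ℓ : Level} (R : CommutativeRing c ℓ) → CharZero R → HasInverses R →
    (n : ℕ) → 1 ≤ n → (G : SimpleGraph n) → (D : Matrix R n) →
    LaplacianIdentity R G D →
    IsTree G × (ZeroDiagonal R D → IsDistanceMatrix R G D)
corollary1 R char0 _ n _ G D identity = (connected , acyclic) , distanceMatrix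
  where
    open Cycles using (acyclic-by-potential)

    connected : Connected G
    connected i j = δ i , δ-walk i
      where open FromRoot R char0 G D identity j

    acyclic : Acyclic G
    acyclic c = acyclic-by-potential G δ no-level-edge unique-lower c
      where open FromRoot R char0 G D identity (Cycle.v c zero)

    distanceMatrix : ZeroDiagonal R D → IsDistanceMatrix R G D
    distanceMatrix zeroDiagonal i j =
      δ i , δ-walk i , (λ _ → δ-minimal) , Column.column zeroDiagonal (δ i) i refl
      where open FromRoot R char0 G D identity j
            open import Relation.Binary.PropositionalEquality using (refl)
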